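{- Let $n\ge1$ and let $w$ be a Kreweras word of length $3n$. Then $\sigma_w=\mathrm{trip}_{W_w}$.
   Context: A Kreweras word of length $3n$ is a word $w=(w_1,\dots,w_{3n})$ in letters $\mathsf A,\mathsf B,\mathsf C$ with $n$ of each letter such that every prefix has at least as many $\mathsf A$'s as $\mathsf B$'s and at least as many $\mathsf A$'s as $\mathsf C$'s. For $\varepsilon\in\{\mathsf B,\mathsf C\}$ let $M^\varepsilon_w$ be the unique noncrossing perfect matching of $\{i:w_i\in\{\mathsf A,\varepsilon\}\}$ by arcs $(i,j)$, $i<j$, $w_i=\mathsf A$, $w_j=\varepsilon$ (no arcs $(i,j),(k,l)$ with $i<k<j<l$). Arcs $(a,b),(c,d)$ of $M^{\mathsf B}_w\cup M^{\mathsf C}_w$ cross if $a\le c<b<d$. Draw $1,\dots,3n$ on a line and the arcs as curves in the upper half plane meeting iff they cross, exactly once (arcs $(a,b),(a,d)$ meet at $a$). Trip permutation $\sigma_w$: walk from $i$: if $w_i\ne\mathsf A$ start along the unique arc at $i$; if $w_i=\mathsf A$ along the arc $(i,i')$ with smaller $i'$. At the meeting point of crossing arcs $(a,b),(c,d)$, $a\le c<b<d$, continue towards $b$ if coming from $a$, towards $a$ if from $c$, towards $d$ if from $b$, towards $c$ if from $d$; stop on reaching a point $j\in\{1,\dots,3n\}$ where these rules do not send it on (arriving at $a$ along $(a,b)$ from $b$, where $(a,b),(a,d)$, $b<d$, are the arcs at $a$, continue along $(a,d)$). Set $\sigma_w(i)=j$. The web $W_w$: replace each meeting point of crossing arcs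 $(a,b),(c,d)$, $a<c<b<d$, by a white vertex incident to the arc-segments towards $a$ and $c$ joined by an edge to a black vertex incident to the arc-segments towards $b$ and $d$; for crossing arcs $(a,b),(a,d)$ join the point $a$ by an edge to a new black vertex incident to the arc-segments towards $b$ and $d$. The points $1,\dots,3n$ become white boundary vertices labeled counterclockwise around a disk; the result is a planar bipartite graph embedded in the disk with boundary vertices of degree one and internal vertices of degree three. Trip permutation of such a web $W$ with $m$ boundary vertices: for $1\le i\le m$ walk from boundary vertex $i$ along its unique edge; at each internal black vertex leave along the next edge counterclockwise from the one of arrival (turn right), at each internal white vertex leave along the next edge clockwise from the one of arrival (turn left); stop on reaching a boundary vertex $j$, and set $\mathrm{trip}_W(i)=j$. -}

module Defs where

open import Data.Nat as ℕ using (ℕ; zero; suc; _≤_; _<_; _*_; _+_; _<ᵇ_; _≡ᵇ_)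
open import Data.Integer as ℤ using (ℤ; +_)
open import Data.Fin using (Fin; toℕ)
open import Data.Vec using (Vec; toList)
open import Data.List using (List; []; _∷_; take)
open import Data.Product using (Σ; _×_; _,_; proj₁; proj₂)
open import Data.Sum using (_⊎_)
open import Data.Unit using (⊤)
open import Data.Empty using (⊥)
open import Data.Bool using (Bool; true; false; if_then_else_)
open import Relation.Nullary using (¬_)
open import Relation.Binary.PropositionalEquality using (_≡_; _≢_)

data Letter : Set where
  A B C : Letter

_==L_ : Letter → Letter → Bool
A ==L A = true
B ==L B = true
C ==L C = true
_ ==L _ = false

count : Letter → List Letter → ℕ
count ℓ [] = 0
count ℓ (x ∷ xs) = if ℓ ==L x then suc (count ℓ xs) else count ℓ xs

-- A Kreweras word of length 3n (positions 1..3n are the Fin indices 0..3n-1).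
Kreweras : (n : ℕ) → Vec Letter (3 * n) → Set
Kreweras n w =
  count A ws ≡ n × count B ws ≡ n × count C ws ≡ n ×
  ((k : ℕ) → count B (take k ws) ≤ count A (take k ws)
           × count C (take k ws) ≤ count A (take k ws))
  where ws = toList w

-- Noncrossing perfect matchings M^ε_w, encoded by a partner function p:
-- the arcs are (i , p i) for w i = A; p restricted to {A-positions}
-- is a bijection onto {ε-positions} with inverse p.

IsNCPM : {N : ℕ} → (Fin N → Letter) → Letter → (Fin N → Fin N) → Set
IsNCPM {N} w ε p =
  ((i : Fin N) → w i ≡ A → w (p i) ≡ ε × toℕ i < toℕ (p i) × p (p i) ≡ i) ×
  ((j : Fin N) → w j ≡ ε → w (p j) ≡ A × p (p j) ≡ j) ×
  ((i k : Fin N) → w i ≡ A → w k ≡ A →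
     ¬ (toℕ i < toℕ k × toℕ k < toℕ (p i) × toℕ (p i) < toℕ (p k)))

-- Webs: planar bipartite graphs in a disk, given as a rotation system
-- (combinatorial map).  Darts are half-edges.

data VKind (m : ℕ) : Set where
  bdry  : Fin m → VKind m
  black : VKind m
  white : VKind m

record Web (m : ℕ) : Set₁ where
  field
    Dart   : Set
    bdart  : Fin m → Dart             -- the unique dart at boundary vertex i
    kind   : Dart → VKind m           -- the vertex a dart is attached to
    Paired : Dart → Dart → Set        -- the two darts of one edge
    ccw    : Dart → Dart
    cw     : Dart → Dart

-- TripRun W d j : leaving along the edge of dart d, the trip ends at j.
data TripRun {m : ℕ} (W : Web m) : Web.Dart W → Fin m → Set where
  arrive : ∀ {d d' j} → Web.Paired W d d' → Web.kind W d' ≡ bdry j → TripRun W d j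
  turnR  : ∀ {d d' j} → Web.Paired W d d' → Web.kind W d' ≡ black →
           TripRun W (Web.ccw W d') j → TripRun W d j
  turnL  : ∀ {d d' j} → Web.Paired W d d' → Web.kind W d' ≡ white →
           TripRun W (Web.cw W d') j → TripRun W d j

Trip : {m : ℕ} (W : Web m) → Fin m → Fin m → Set
Trip W i j = TripRun W (Web.bdart W i) j

data Node {N : ℕ} : Set where
  start : Node
  mid   : Fin N × Fin N → Node      -- the meeting point with another arc
  end   : Node

data Dir : Set where
  toStart toEnd : Dir

module Construction {N : ℕ} (w : Fin N → Letter) (pB pC : Fin N → Fin N) where

  Arc : Set
  Arc = Fin N × Fin N

  left right : Arc → Fin N
  left = proj₁
  right = proj₂

  ArcOf : Arc → Set
  ArcOf e = w (left e) ≡ A × (right e ≡ pB (left e) ⊎ right e ≡ pC (left e))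

  Crosses : Arc → Arc → Set
  Crosses (a , b) (c , d) =
    (toℕ a < toℕ c × toℕ c < toℕ b × toℕ b < toℕ d) ⊎
    (toℕ c < toℕ a × toℕ a < toℕ d × toℕ d < toℕ b)

  -- Semicircle drawing: the crossing of e=(a,b), f=(c,d) has x-coordinate
  -- (cd-ab)/(c+d-a-b); xNum/xDen is this fraction with positive denominator.
  xNum xDen : Arc → Arc → ℤ
  xNum (a , b) (c , d) =
    if toℕ a <ᵇ toℕ c then (+ (toℕ c * toℕ d)) ℤ.- (+ (toℕ a * toℕ b))
                      else (+ (toℕ a * toℕ b)) ℤ.- (+ (toℕ c * toℕ d))
  xDen (a , b) (c , d) =
    if toℕ a <ᵇ toℕ c then (+ (toℕ c + toℕ d)) ℤ.- (+ (toℕ a + toℕ b))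
                      else (+ (toℕ a + toℕ b)) ℤ.- (+ (toℕ c + toℕ d))

  OnArc : Arc → Node {N} → Set
  OnArc e start = ⊤
  OnArc e (mid f) = ArcOf f × Crosses e f
  OnArc e end = ⊤

  -- order of nodes along e from its left end to its right end
  NLt : Arc → Node {N} → Node {N} → Set
  NLt e start (mid _) = ⊤
  NLt e start end = ⊤
  NLt e (mid _) end = ⊤
  NLt e (mid f) (mid g) = xNum e f ℤ.* xDen e g ℤ.< xNum e g ℤ.* xDen e f
  NLt e _ _ = ⊥

  Succ : Arc → Node {N} → Node {N} → Set
  Succ e x y = OnArc e x × OnArc e y × NLt e x y ×
               ((z : Node) → OnArc e z → NLt e x z → ¬ NLt e z y)

  small large : Fin N → Arc
  small a = if toℕ (pB a) <ᵇ toℕ (pC a) then (a , pB a) else (a , pC a)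
  large a = if toℕ (pB a) <ᵇ toℕ (pC a) then (a , pC a) else (a , pB a)

  endArc : Fin N → Arc
  endArc j with w j
  ... | A = (j , j)
  ... | B = (pB j , j)
  ... | C = (pC j , j)

  First : Arc → Arc → Set
  First e f = toℕ (left e) < toℕ (left f)

  -- SRun e x dir j : having arrived at node x of e while moving in
  -- direction dir along e, the walk of σ_w stops at j.
  data SRun : Arc → Node {N} → Dir → Fin N → Set where
    stopEnd : ∀ {e} → SRun e end toEnd (right e)
    stopA   : ∀ {e} → e ≡ large (left e) → SRun e start toStart (left e)
    turnA   : ∀ {e y j} → e ≡ small (left e) → Succ (large (left e)) start y →
              SRun (large (left e)) y toEnd j → SRun e start toStart j
    -- e = (a,b) first, f = (c,d): coming from a, go towards b
    fromA   : ∀ {e f y j} → First e f → Succ e (mid f) y →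
              SRun e y toEnd j → SRun e (mid f) toEnd j
    -- e = (a,b) first, f = (c,d): coming from b, go towards d
    fromB   : ∀ {e f y j} → First e f → Succ f (mid e) y →
              SRun f y toEnd j → SRun e (mid f) toStart j
    -- f = (a,b) first, e = (c,d): coming from c, go towards a
    fromC   : ∀ {e f y j} → First f e → Succ f y (mid e) →
              SRun f y toStart j → SRun e (mid f) toEnd j
    -- f = (a,b) first, e = (c,d): coming from d, go towards c
    fromD   : ∀ {e f y j} → First f e → Succ e y (mid f) →
              SRun e y toStart j → SRun e (mid f) toStart j

  Sigma : Fin N → Fin N → Set
  Sigma i j =
    (w i ≡ A × Σ Node (λ y → Succ (small i) start y × SRun (small i) y toEnd j)) ⊎
    (w i ≢ A × Σ Node (λ y → Succ (endArc i) y end × SRun (endArc i) y toStart j))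

  data WDart : Set where
    bd  : Fin N → WDart
    tT  : Fin N → WDart                -- at the black vertex T_a, towards a
    seg : Arc → Node {N} → Dir → WDart -- at node x of e, along e in direction dir
    wb  : Arc → Arc → WDart            -- at the white vertex of crossing (e,f), towards black
    bw  : Arc → Arc → WDart            -- at the black vertex of crossing (e,f), towards white

  kindW : WDart → VKind N
  kindW (bd i) = bdry i
  kindW (tT _) = black
  kindW (seg _ start _) = black
  kindW (seg _ (mid _) toStart) = white
  kindW (seg _ (mid _) toEnd) = black
  kindW (seg _ end _) = black          -- never a dart of W_w
  kindW (wb _ _) = white
  kindW (bw _ _) = black

  data PairedW : WDart → WDart → Set where
    pA  : ∀ {a} → w a ≡ A → PairedW (bd a) (tT a)
    pA' : ∀ {a} → w a ≡ A → PairedW (tT a) (bd a)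
    pX  : ∀ {e f} → PairedW (wb e f) (bw e f)
    pX' : ∀ {e f} → PairedW (bw e f) (wb e f)
    pS  : ∀ {e x g} → ArcOf e → Succ e x (mid g) →
          PairedW (seg e x toEnd) (seg e (mid g) toStart)
    pS' : ∀ {e x g} → ArcOf e → Succ e x (mid g) →
          PairedW (seg e (mid g) toStart) (seg e x toEnd)
    pE  : ∀ {e x} → ArcOf e → Succ e x end → PairedW (seg e x toEnd) (bd (right e))
    pE' : ∀ {e x} → ArcOf e → Succ e x end → PairedW (bd (right e)) (seg e x toEnd)

  -- Cyclic orders (counterclockwise): at T_a: (towards a, smaller arc, larger arc);
  -- white vertex of crossing (e first, f second): (towards a, towards c, edge);
  -- black vertex: (towards b, towards d, edge).
  ccwW : WDart → WDart
  ccwW (bd i) = bd i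
  ccwW (tT a) = seg (small a) start toEnd
  ccwW (seg e start d) =
    if toℕ (right e) ≡ᵇ toℕ (right (small (left e)))
    then seg (large (left e)) start toEnd else tT (left e)
  ccwW (seg e (mid f) toStart) =
    if toℕ (left e) <ᵇ toℕ (left f) then seg f (mid e) toStart else wb f e
  ccwW (seg e (mid f) toEnd) =
    if toℕ (left e) <ᵇ toℕ (left f) then seg f (mid e) toEnd else bw f e
  ccwW (seg e end d) = seg e end d
  ccwW (wb e f) = seg e (mid f) toStart
  ccwW (bw e f) = seg e (mid f) toEnd

  cwW : WDart → WDart
  cwW (bd i) = bd i
  cwW (tT a) = seg (large a) start toEnd
  cwW (seg e start d) =
    if toℕ (right e) ≡ᵇ toℕ (right (small (left e)))
    then tT (left e) else seg (small (left e)) start toEnd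
  cwW (seg e (mid f) toStart) =
    if toℕ (left e) <ᵇ toℕ (left f) then wb e f else seg f (mid e) toStart
  cwW (seg e (mid f) toEnd) =
    if toℕ (left e) <ᵇ toℕ (left f) then bw e f else seg f (mid e) toEnd
  cwW (seg e end d) = seg e end d
  cwW (wb e f) = seg f (mid e) toStart
  cwW (bw e f) = seg f (mid e) toEnd

  webW : Web N
  webW = record
    { Dart = WDart ; bdart = bd ; kind = kindW ; Paired = PairedW
    ; ccw = ccwW ; cw = cwW }

module Submission where

open import Defs
open import Data.Nat using (ℕ)
open import Data.Fin using (Fin)

-- Both σ_w and trip walk along the same curves.  At a crossing of (a , b) and (c , d) with
-- a < c the web has a white vertex on the side of a and c and a black vertex on the side of
-- b and d, so turning left at white and right at black vertices reproduces the four rules of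
-- σ_w; at an A-position a the black vertex T_a sends the walk out along the smaller arc and
-- back along the larger one.  Hence the two walks correspond step by step, provided the
-- points on every arc are totally ordered.  They are: two arcs crossing a given arc belong to
-- the same noncrossing matching, so they are nested or disjoint, and nested or disjoint
-- semicircles have different heights over every abscissa, so they cannot meet the given arc at
-- the same point.  Finally σ_w is total because its walk is an injective step function on a
-- finite set of states whose initial state has no predecessor, so it cannot cycle.

module Semicircles where

  open import Data.Integer as ℤ using (ℤ; 0ℤ; _+_; _-_; _*_; _<_; -_; positive)
  open import Data.Integer.Properties as ℤₚ using ()
  open import Data.Integer.Tactic.RingSolver using (solve-∀)
  open import Data.Product using (_×_; _,_)
  open import Data.Sum using (_⊎_; inj₁; inj₂)
  open import Relation.Nullary using (¬_)
  open import Relation.Binary.PropositionalEquality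

  0<_ : ℤ → Set
  0< x = 0ℤ < x

  0<-* : ∀ {x y} → 0< x → 0< y → 0< (x * y)
  0<-* {x} {y} 0<x 0<y = subst (_< x * y) (ℤₚ.*-zeroˡ y) (ℤₚ.*-monoʳ-<-pos y {{positive 0<y}} 0<x)

  0<-+ : ∀ {x y} → 0< x → 0< y → 0< (x + y)
  0<-+ = ℤₚ.+-mono-<

  <⇒0<- : ∀ {x y} → x < y → 0< (y - x)
  <⇒0<- {x} {y} x<y = subst (_< y - x) (ℤₚ.+-inverseʳ x) (ℤₚ.+-monoˡ-< (- x) x<y)

  x≢x+0< : ∀ x {p} → 0< p → x ≢ x + p
  x≢x+0< x {p} 0<p eq = ℤₚ.<-irrefl eq (subst (_< x + p) (ℤₚ.+-identityʳ x) (ℤₚ.+-monoʳ-< x 0<p))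

  DisjointOrNested : ℤ → ℤ → ℤ → ℤ → Set
  DisjointOrNested c d c′ d′ = d < c′ ⊎ d′ < c ⊎ (c < c′ × d′ < d) ⊎ (c′ < c × d < d′)

  DisjointOrNested-sym : ∀ {c d c′ d′} → DisjointOrNested c d c′ d′ → DisjointOrNested c′ d′ c d
  DisjointOrNested-sym (inj₁ d<c′) = inj₂ (inj₁ d<c′)
  DisjointOrNested-sym (inj₂ (inj₁ d′<c)) = inj₁ d′<c
  DisjointOrNested-sym (inj₂ (inj₂ (inj₁ nested))) = inj₂ (inj₂ (inj₂ nested))
  DisjointOrNested-sym (inj₂ (inj₂ (inj₂ nested))) = inj₂ (inj₂ (inj₁ nested))

  -- Up to the factor - E², (X - c E) (X - d E) is the squared height over X / E of the semicircle on [c , d].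
  same-height⇒¬disjointOrNested : ∀ X E c d c′ d′ → 0< E →
    0< (X - c * E) → 0< (d * E - X) → 0< (X - c′ * E) → 0< (d′ * E - X) →
    (X - c * E) * (X - d * E) ≡ (X - c′ * E) * (X - d′ * E) → ¬ DisjointOrNested c d c′ d′
  same-height⇒¬disjointOrNested X E c d c′ d′ 0<E _ d>x c′<x _ _ (inj₁ d<c′) =
    ℤₚ.<-irrefl refl (subst 0<_ (gap X E d c′) (0<-+ (0<-+ d>x c′<x) (0<-* (<⇒0<- d<c′) 0<E)))
    where
    gap : ∀ X E d c′ → (d * E - X) + (X - c′ * E) + (c′ - d) * E ≡ 0ℤ
    gap = solve-∀
  same-height⇒¬disjointOrNested X E c d c′ d′ 0<E c<x _ _ d′>x _ (inj₂ (inj₁ d′<c)) =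
    ℤₚ.<-irrefl refl (subst 0<_ (gap X E c d′) (0<-+ (0<-+ c<x d′>x) (0<-* (<⇒0<- d′<c) 0<E)))
    where
    gap : ∀ X E c d′ → (X - c * E) + (d′ * E - X) + (c - d′) * E ≡ 0ℤ
    gap = solve-∀
  same-height⇒¬disjointOrNested X E c d c′ d′ 0<E _ d>x c′<x _ eq
    (inj₂ (inj₂ (inj₁ (c<c′ , d′<d)))) =
    x≢x+0< _ (0<-+ (0<-* (0<-* (<⇒0<- c<c′) 0<E) d>x) (0<-* c′<x (0<-* (<⇒0<- d′<d) 0<E)))
      (trans eq (split X E c d c′ d′))
    where
    split : ∀ X E c d c′ d′ → (X - c′ * E) * (X - d′ * E) ≡
      (X - c * E) * (X - d * E) + ((c′ - c) * E * (d * E - X) + (X - c′ * E) * ((d - d′) * E))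
    split = solve-∀
  same-height⇒¬disjointOrNested X E c d c′ d′ 0<E c<x _ _ d′>x eq
    (inj₂ (inj₂ (inj₂ (c′<c , d<d′)))) =
    x≢x+0< _ (0<-+ (0<-* (0<-* (<⇒0<- c′<c) 0<E) d′>x) (0<-* c<x (0<-* (<⇒0<- d<d′) 0<E)))
      (trans (sym eq) (split X E c d c′ d′))
    where
    split : ∀ X E c d c′ d′ → (X - c * E) * (X - d * E) ≡
      (X - c′ * E) * (X - d′ * E) + ((c - c′) * E * (d′ * E - X) + (X - c * E) * ((d′ - d) * E))
    split = solve-∀

  -- N / D is the abscissa of a common point of the semicircles on [a , b] and [c , d].
  record MeetAt (a b c d N D : ℤ) : Set where
    field
      0<den       : 0< D
      right-of-c  : 0< (N - c * D)
      left-of-d   : 0< (d * D - N)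
      same-height : (N - a * D) * (N - b * D) ≡ (N - c * D) * (N - d * D)

  -- Equating the squared heights (x - a) (b - x) and (x - c) (d - x) gives a linear equation in x.
  semicircles-meet : ∀ {a b c d} → a < c → c < b → b < d →
    MeetAt a b c d (c * d - a * b) ((c + d) - (a + b))
  semicircles-meet {a} {b} {c} {d} a<c c<b b<d = record
    { 0<den       = subst 0<_ (den a b c d) (0<-+ (<⇒0<- a<c) (<⇒0<- b<d))
    ; right-of-c  = subst 0<_ (num-c a b c d) (0<-* (<⇒0<- a<c) (<⇒0<- c<b))
    ; left-of-d   = subst 0<_ (num-d a b c d)
                      (0<-* (<⇒0<- (ℤₚ.<-trans a<c (ℤₚ.<-trans c<b b<d))) (<⇒0<- b<d))
    ; same-height = heights a b c d
    }
    where
    den : ∀ a b c d → (c - a) + (d - b) ≡ (c + d) - (a + b)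
    den = solve-∀
    num-c : ∀ a b c d → (c - a) * (b - c) ≡ (c * d - a * b) - c * ((c + d) - (a + b))
    num-c = solve-∀
    num-d : ∀ a b c d → (d - a) * (d - b) ≡ d * ((c + d) - (a + b)) - (c * d - a * b)
    num-d = solve-∀
    heights : ∀ a b c d →
      (c * d - a * b - a * ((c + d) - (a + b))) * (c * d - a * b - b * ((c + d) - (a + b))) ≡
      (c * d - a * b - c * ((c + d) - (a + b))) * (c * d - a * b - d * ((c + d) - (a + b)))
    heights = solve-∀

  semicircles-meet′ : ∀ {a b c d} → c < a → a < d → d < b →
    MeetAt a b c d (a * b - c * d) ((a + b) - (c + d))
  semicircles-meet′ {a} {b} {c} {d} c<a a<d d<b = record
    { 0<den       = subst 0<_ (den a b c d) (0<-+ (<⇒0<- c<a) (<⇒0<- d<b))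
    ; right-of-c  = subst 0<_ (num-c a b c d)
                      (0<-* (<⇒0<- c<a) (<⇒0<- (ℤₚ.<-trans c<a (ℤₚ.<-trans a<d d<b))))
    ; left-of-d   = subst 0<_ (num-d a b c d) (0<-* (<⇒0<- a<d) (<⇒0<- d<b))
    ; same-height = heights a b c d
    }
    where
    den : ∀ a b c d → (a - c) + (b - d) ≡ (a + b) - (c + d)
    den = solve-∀
    num-c : ∀ a b c d → (a - c) * (b - c) ≡ (a * b - c * d) - c * ((a + b) - (c + d))
    num-c = solve-∀
    num-d : ∀ a b c d → (d - a) * (b - d) ≡ d * ((a + b) - (c + d)) - (a * b - c * d)
    num-d = solve-∀
    heights : ∀ a b c d →
      (a * b - c * d - a * ((a + b) - (c + d))) * (a * b - c * d - b * ((a + b) - (c + d))) ≡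
      (a * b - c * d - c * ((a + b) - (c + d))) * (a * b - c * d - d * ((a + b) - (c + d)))
    heights = solve-∀

  MeetAt-scale : ∀ {a b c d N D K} → 0< K → MeetAt a b c d N D → MeetAt a b c d (N * K) (D * K)
  MeetAt-scale {a} {b} {c} {d} {N} {D} {K} 0<K m = record
    { 0<den       = 0<-* 0<den 0<K
    ; right-of-c  = subst 0<_ (sym (shift N D K c)) (0<-* right-of-c 0<K)
    ; left-of-d   = subst 0<_ (sym (shift′ N D K d)) (0<-* left-of-d 0<K)
    ; same-height = begin
        (N * K - a * (D * K)) * (N * K - b * (D * K)) ≡⟨ square N D K a b ⟩
        (N - a * D) * (N - b * D) * (K * K)           ≡⟨ cong (_* (K * K)) same-height ⟩
        (N - c * D) * (N - d * D) * (K * K)           ≡⟨ square N D K c d ⟨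
        (N * K - c * (D * K)) * (N * K - d * (D * K)) ∎
    }
    where
    open MeetAt m
    open ≡-Reasoning
    shift : ∀ N D K u → N * K - u * (D * K) ≡ (N - u * D) * K
    shift = solve-∀
    shift′ : ∀ N D K u → u * (D * K) - N * K ≡ (u * D - N) * K
    shift′ = solve-∀
    square : ∀ N D K u v → (N * K - u * (D * K)) * (N * K - v * (D * K)) ≡ (N - u * D) * (N - v * D) * (K * K)
    square = solve-∀

  meetAt-same-point : ∀ {a b c d c′ d′ N D N′ D′} → MeetAt a b c d N D → MeetAt a b c′ d′ N′ D′ →
    N * D′ ≡ N′ * D → ¬ DisjointOrNested c d c′ d′
  meetAt-same-point {a} {b} {c} {d} {c′} {d′} {N} {D} {N′} {D′} m m′ eq =
    same-height⇒¬disjointOrNested (N * D′) (D * D′) c d c′ d′ 0<den right-of-c left-of-d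
      (MeetAt.right-of-c s′) (MeetAt.left-of-d s′)
      (trans (sym same-height) (MeetAt.same-height s′))
    where
    s′ : MeetAt a b c′ d′ (N * D′) (D * D′)
    s′ = subst₂ (MeetAt a b c′ d′) (sym eq) (ℤₚ.*-comm D′ D) (MeetAt-scale (MeetAt.0<den m) m′)
    open MeetAt (MeetAt-scale (MeetAt.0<den m′) m)

  fraction-<-trans : ∀ {n₁ d₁ n₂ d₂ n₃ d₃} → 0< d₁ → 0< d₂ → 0< d₃ →
    n₁ * d₂ < n₂ * d₁ → n₂ * d₃ < n₃ * d₂ → n₁ * d₃ < n₃ * d₁
  fraction-<-trans {n₁} {d₁} {n₂} {d₂} {n₃} {d₃} 0<d₁ 0<d₂ 0<d₃ lt₁ lt₂ =
    ℤₚ.*-cancelʳ-<-nonNeg d₂ {{ℤ.nonNegative (ℤₚ.<⇒≤ 0<d₂)}}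
      (subst₂ _<_ (swap n₁ d₂ d₃) (swap n₃ d₂ d₁)
        (ℤₚ.<-trans (ℤₚ.*-monoʳ-<-pos d₃ {{positive 0<d₃}} lt₁)
          (subst (_< n₃ * d₂ * d₁) (swap n₂ d₃ d₁) (ℤₚ.*-monoʳ-<-pos d₁ {{positive 0<d₁}} lt₂))))
    where
    swap : ∀ n d x → n * d * x ≡ n * x * d
    swap = solve-∀

module Finite where

  open import Data.Nat as ℕ using (ℕ; zero; suc; _<_; _≤_; s≤s)
  open import Data.Nat.Properties as ℕₚ using ()
  open import Data.Fin using (Fin; toℕ)
  open import Data.Fin.Properties using (pigeonhole; toℕ≤pred[n])
  open import Data.List using (List; []; _∷_)
  open import Data.List.Membership.Propositional using (_∈_)
  open import Data.List.Relation.Unary.Any using (here; there)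
  open import Data.Product using (Σ; ∃; _×_; _,_)
  open import Data.Sum using (_⊎_; inj₁; inj₂; [_,_])
  open import Data.Empty using (⊥; ⊥-elim)
  open import Relation.Nullary using (¬_; yes; no)
  open import Relation.Nullary.Decidable using (_×-dec_)
  open import Relation.Unary using () renaming (Decidable to Decidable₁)
  open import Relation.Binary using (Decidable)
  open import Relation.Binary.PropositionalEquality using (_≡_; _≢_; refl; sym; trans; cong)

  module ImmediateSuccessor {X : Set} (On : X → Set) (On? : Decidable₁ On)
    (_≺_ : X → X → Set) (_≺?_ : Decidable _≺_)
    (≺-trans : ∀ {x y z} → On x → On y → On z → x ≺ y → y ≺ z → x ≺ z)
    (≺-irrefl : ∀ {x} → ¬ x ≺ x) where

    NotBetween : X → X → X → Set
    NotBetween x y z = On z → x ≺ z → ¬ z ≺ y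

    Covers : X → X → Set
    Covers x y = On y × x ≺ y × (∀ z → NotBetween x y z)

    private
      shrink : ∀ x (zs : List X) y → On y → x ≺ y →
        Σ X λ b → On b × x ≺ b × (∀ z → NotBetween x y z → NotBetween x b z) ×
                  (∀ z → z ∈ zs → NotBetween x b z)
      shrink x [] y on-y x≺y = y , on-y , x≺y , (λ _ nb → nb) , λ _ ()
      shrink x (z ∷ zs) y on-y x≺y with On? z ×-dec x ≺? z ×-dec z ≺? y
      ... | yes (on-z , x≺z , z≺y) =
        let b , on-b , x≺b , mono , done = shrink x zs z on-z x≺z
        in b , on-b , x≺b ,
           (λ u nb → mono u (λ on-u x≺u u≺z → nb on-u x≺u (≺-trans on-u on-z on-y u≺z z≺y))) ,
           λ { _ (here refl) → mono z (λ _ _ → ≺-irrefl) ; u (there u∈zs) → done u u∈zs }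
      ... | no ¬between =
        let b , on-b , x≺b , mono , done = shrink x zs y on-y x≺y
        in b , on-b , x≺b , mono ,
           λ { _ (here refl) → mono z (λ on-z x≺z z≺y → ¬between (on-z , x≺z , z≺y))
             ; u (there u∈zs) → done u u∈zs }

    cover : (xs : List X) → (∀ z → z ∈ xs) → ∀ x y → On y → x ≺ y → ∃ (Covers x)
    cover xs complete x y on-y x≺y =
      let b , on-b , x≺b , _ , done = shrink x xs y on-y x≺y
      in b , on-b , x≺b , λ z → done z (complete z)

  module InjectiveIteration {S R : Set} (step : S → S ⊎ R) (Inv : S → Set)
    (step-inv : ∀ {s t} → Inv s → step s ≡ inj₁ t → Inv t)
    (step-injective : ∀ {s s′ t} → Inv s → Inv s′ → step s ≡ inj₁ t → step s′ ≡ inj₁ t → s ≡ s′)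
    {M : ℕ} (code : S → Fin M) (code-injective : ∀ {s t} → code s ≡ code t → s ≡ t) where

    iterate : ℕ → S → S ⊎ R
    iterate zero s = inj₁ s
    iterate (suc k) s = [ step , inj₂ ] (iterate k s)

    module _ (s₀ : S) (inv₀ : Inv s₀) where

      iterate-inv : ∀ k {t} → iterate k s₀ ≡ inj₁ t → Inv t
      iterate-inv zero refl = inv₀
      iterate-inv (suc k) eq with iterate k s₀ in eqₖ
      ... | inj₁ _ = step-inv (iterate-inv k eqₖ) eq

      iterate-halted : ∀ k d {r} → iterate k s₀ ≡ inj₂ r → iterate (d ℕ.+ k) s₀ ≡ inj₂ r
      iterate-halted k zero eq = eq
      iterate-halted k (suc d) eq rewrite iterate-halted k d eq = refl

      module _ (no-pred : ∀ t → Inv t → step t ≢ inj₁ s₀) where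

        -- A repetition, pulled back along the injective step, would give s₀ a predecessor.
        iterate-distinct : ∀ k k′ {t} → k < k′ → iterate k s₀ ≡ inj₁ t → iterate k′ s₀ ≡ inj₁ t → ⊥
        iterate-distinct zero (suc k′) _ refl eq′ with iterate k′ s₀ in eqₖ′
        ... | inj₁ t = no-pred t (iterate-inv k′ eqₖ′) eq′
        iterate-distinct (suc k) (suc k′) (s≤s k<k′) eq eq′ with iterate k s₀ in eqₖ | iterate k′ s₀ in eqₖ′
        ... | inj₁ _ | inj₁ _ with step-injective (iterate-inv k eqₖ) (iterate-inv k′ eqₖ′) eq eq′
        ...   | refl = iterate-distinct k k′ k<k′ eqₖ eqₖ′

        private
          state : S ⊎ R → S
          state = [ (λ s → s) , (λ _ → s₀) ]

        halts : ∃ λ r → ∃ λ k → iterate k s₀ ≡ inj₂ r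
        halts with iterate M s₀ in eqM
        ... | inj₂ r = r , M , eqM
        ... | inj₁ _ with pigeonhole (ℕₚ.n<1+n M) (λ i → code (state (iterate (toℕ i) s₀)))
        ...   | i , j , i<j , same-code =
          ⊥-elim (iterate-distinct (toℕ i) (toℕ j) i<j
            (trans (running (toℕ i) (toℕ≤pred[n] i)) (cong inj₁ (code-injective same-code)))
            (running (toℕ j) (toℕ≤pred[n] j)))
          where
          running : ∀ k → k ≤ M → iterate k s₀ ≡ inj₁ (state (iterate k s₀))
          running k k≤M with iterate k s₀ in eqₖ
          ... | inj₁ _ = refl
          ... | inj₂ _ with trans (sym (iterate-halted k (M ℕ.∸ k) eqₖ))
                                  (trans (cong (λ m → iterate m s₀) (ℕₚ.m∸n+n≡m k≤M)) eqM)
          ...   | ()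

        module _ (Result : S → R → Set)
          (result-step : ∀ {t u r} → Inv t → step t ≡ inj₁ u → Result u r → Result t r)
          (result-halt : ∀ {t r} → Inv t → step t ≡ inj₂ r → Result t r) where

          private
            pull-back : ∀ k {t r} → iterate k s₀ ≡ inj₁ t → Result t r → Result s₀ r
            pull-back zero refl res = res
            pull-back (suc k) eq res with iterate k s₀ in eqₖ
            ... | inj₁ _ = pull-back k eqₖ (result-step (iterate-inv k eqₖ) eq res)

            halted : ∀ k {r} → iterate k s₀ ≡ inj₂ r → Result s₀ r
            halted (suc k) eq with iterate k s₀ in eqₖ
            ... | inj₁ _ = pull-back k eqₖ (result-halt (iterate-inv k eqₖ) eq)
            ... | inj₂ _ with eq
            ...   | refl = halted k eqₖ

          result : ∃ (Result s₀)
          result = let r , k , eq = halts in r , halted k eq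

module ArcDiagram {N : ℕ} (w : Fin N → Letter) (pB pC : Fin N → Fin N)
                  (ncB : IsNCPM w B pB) (ncC : IsNCPM w C pC) where

  open Semicircles
  open Finite
  open import Data.Nat as ℕ using (_<_; _<ᵇ_; _≡ᵇ_)
  open import Data.Nat.Properties as ℕₚ using ()
  open import Data.Integer as ℤ using (ℤ; +_; _*_)
  open import Data.Integer.Properties as ℤₚ using ()
  open import Data.Fin as Fin using (toℕ)
  open import Data.Fin.Properties using (toℕ-injective; suc-injective; combine-injective)
  open import Data.Bool using (Bool; true; false; if_then_else_)
  open import Data.Bool.Properties using (T-≡)
  open import Data.Product using (∃; _×_; _,_; proj₁; proj₂)
  open import Data.Product.Properties using (≡-dec)
  open import Data.Sum using (_⊎_; inj₁; inj₂)
  open import Data.Unit using (tt)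
  open import Data.List using (List; _∷_; map; cartesianProduct; allFin)
  open import Data.List.Membership.Propositional using (_∈_)
  open import Data.List.Membership.Propositional.Properties using (∈-map⁺; ∈-cartesianProduct⁺; ∈-allFin)
  open import Data.List.Relation.Unary.Any using (here; there)
  open import Function.Base using (flip; _∘_)
  open import Data.Empty using (⊥-elim)
  open import Function.Bundles using (Equivalence)
  open import Relation.Nullary using (¬_; Dec; yes; no; contradiction)
  open import Relation.Nullary.Decidable using (_×-dec_; _⊎-dec_)
  open import Relation.Binary using (DecidableEquality; tri<; tri≈; tri>)
  open import Relation.Binary.PropositionalEquality

  open Construction w pB pC

  <ᵇ≡true : ∀ {m n} → m < n → (m <ᵇ n) ≡ true
  <ᵇ≡true m<n = Equivalence.to T-≡ (ℕₚ.<⇒<ᵇ m<n)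

  <ᵇ≡false : ∀ {m n} → ¬ m < n → (m <ᵇ n) ≡ false
  <ᵇ≡false {m} {n} m≮n with m <ᵇ n in eq
  ... | true = ⊥-elim (m≮n (ℕₚ.<ᵇ⇒< m n (Equivalence.from T-≡ eq)))
  ... | false = refl

  ≡ᵇ≡true : ∀ {m n} → m ≡ n → (m ≡ᵇ n) ≡ true
  ≡ᵇ≡true {m} {n} m≡n = Equivalence.to T-≡ (ℕₚ.≡⇒≡ᵇ m n m≡n)

  ≡ᵇ≡false : ∀ {m n} → m ≢ n → (m ≡ᵇ n) ≡ false
  ≡ᵇ≡false {m} {n} m≢n with m ≡ᵇ n in eq
  ... | true = ⊥-elim (m≢n (ℕₚ.≡ᵇ⇒≡ m n (Equivalence.from T-≡ eq)))
  ... | false = refl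

  _≟ᴸ_ : DecidableEquality Letter
  A ≟ᴸ A = yes refl
  B ≟ᴸ B = yes refl
  C ≟ᴸ C = yes refl
  A ≟ᴸ B = no λ ()
  A ≟ᴸ C = no λ ()
  B ≟ᴸ A = no λ ()
  B ≟ᴸ C = no λ ()
  C ≟ᴸ A = no λ ()
  C ≟ᴸ B = no λ ()

  _≟ᵃ_ : DecidableEquality Arc
  _≟ᵃ_ = ≡-dec Fin._≟_ Fin._≟_

  data Colour : Set where
    εB εC : Colour

  letter : Colour → Letter
  letter εB = B
  letter εC = C

  partner : Colour → Fin N → Fin N
  partner εB = pB
  partner εC = pC

  partner-isNCPM : ∀ ε → IsNCPM w (letter ε) (partner ε)
  partner-isNCPM εB = ncB
  partner-isNCPM εC = ncC

  letter≢A : ∀ ε → letter ε ≢ A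
  letter≢A εB ()
  letter≢A εC ()

  module _ (ε : Colour) {a : Fin N} (wa : w a ≡ A) where

    partner-letter : w (partner ε a) ≡ letter ε
    partner-letter = proj₁ (proj₁ (partner-isNCPM ε) a wa)

    partner-involutive : partner ε (partner ε a) ≡ a
    partner-involutive = proj₂ (proj₂ (proj₁ (partner-isNCPM ε) a wa))

  partner-injective : ∀ ε {a c} → w a ≡ A → w c ≡ A → partner ε a ≡ partner ε c → a ≡ c
  partner-injective ε wa wc eq =
    trans (sym (partner-involutive ε wa)) (trans (cong (partner ε) eq) (partner-involutive ε wc))

  partner-noncrossing : ∀ ε {a c} → w a ≡ A → w c ≡ A →
    ¬ (toℕ a < toℕ c × toℕ c < toℕ (partner ε a) × toℕ (partner ε a) < toℕ (partner ε c))
  partner-noncrossing ε wa wc = proj₂ (proj₂ (partner-isNCPM ε)) _ _ wa wc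

  pB≢pC : ∀ {a} → w a ≡ A → pB a ≢ pC a
  pB≢pC wa eq with trans (sym (partner-letter εB wa)) (trans (cong w eq) (partner-letter εC wa))
  ... | ()

  Coloured : Colour → Arc → Set
  Coloured ε (a , b) = w a ≡ A × b ≡ partner ε a

  colour : ∀ {e} → ArcOf e → ∃ λ ε → Coloured ε e
  colour (wa , inj₁ b≡pB) = εB , wa , b≡pB
  colour (wa , inj₂ b≡pC) = εC , wa , b≡pC

  ArcOf? : ∀ e → Dec (ArcOf e)
  ArcOf? (a , b) = (w a ≟ᴸ A) ×-dec ((b Fin.≟ pB a) ⊎-dec (b Fin.≟ pC a))

  Crosses? : ∀ e f → Dec (Crosses e f)
  Crosses? (a , b) (c , d) =
    (toℕ a ℕₚ.<? toℕ c ×-dec toℕ c ℕₚ.<? toℕ b ×-dec toℕ b ℕₚ.<? toℕ d) ⊎-dec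
    (toℕ c ℕₚ.<? toℕ a ×-dec toℕ a ℕₚ.<? toℕ d ×-dec toℕ d ℕₚ.<? toℕ b)

  OnArc? : ∀ e x → Dec (OnArc e x)
  OnArc? e start = yes tt
  OnArc? e (mid f) = ArcOf? f ×-dec Crosses? e f
  OnArc? e end = yes tt

  NLt? : ∀ e x y → Dec (NLt e x y)
  NLt? e start start = no λ ()
  NLt? e start (mid _) = yes tt
  NLt? e start end = yes tt
  NLt? e (mid _) start = no λ ()
  NLt? e (mid f) (mid g) = (xNum e f * xDen e g) ℤₚ.<? (xNum e g * xDen e f)
  NLt? e (mid _) end = yes tt
  NLt? e end _ = no λ ()

  coord : Fin N → ℤ
  coord i = + toℕ i

  coord-< : ∀ {i j} → toℕ i < toℕ j → coord i ℤ.< coord j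
  coord-< = ℤ.+<+

  MeetsAlong : Arc → Arc → Set
  MeetsAlong e f = MeetAt (coord (left e)) (coord (right e)) (coord (left f)) (coord (right f)) (xNum e f) (xDen e f)

  crossing-meets : ∀ e f → Crosses e f → MeetsAlong e f
  crossing-meets (a , b) (c , d) (inj₁ (a<c , c<b , b<d))
    rewrite <ᵇ≡true a<c | ℤₚ.pos-* (toℕ c) (toℕ d) | ℤₚ.pos-* (toℕ a) (toℕ b)
          | ℤₚ.pos-+ (toℕ c) (toℕ d) | ℤₚ.pos-+ (toℕ a) (toℕ b) =
    semicircles-meet (coord-< a<c) (coord-< c<b) (coord-< b<d)
  crossing-meets (a , b) (c , d) (inj₂ (c<a , a<d , d<b))
    rewrite <ᵇ≡false (ℕₚ.<⇒≯ c<a) | ℤₚ.pos-* (toℕ c) (toℕ d) | ℤₚ.pos-* (toℕ a) (toℕ b)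
          | ℤₚ.pos-+ (toℕ c) (toℕ d) | ℤₚ.pos-+ (toℕ a) (toℕ b) =
    semicircles-meet′ (coord-< c<a) (coord-< a<d) (coord-< d<b)

  coloured-noncrossing : ∀ {ε e f} → Coloured ε e → Coloured ε f → ¬ Crosses e f
  coloured-noncrossing {ε} (wa , refl) (wc , refl) (inj₁ a<c<pa<pc) = partner-noncrossing ε wa wc a<c<pa<pc
  coloured-noncrossing {ε} (wa , refl) (wc , refl) (inj₂ c<a<pc<pa) = partner-noncrossing ε wc wa c<a<pc<pa

  private
    ordered-disjointOrNested : ∀ ε {c c′} → w c ≡ A → w c′ ≡ A → toℕ c < toℕ c′ →
      DisjointOrNested (coord c) (coord (partner ε c)) (coord c′) (coord (partner ε c′))
    ordered-disjointOrNested ε {c} {c′} wc wc′ c<c′ with ℕₚ.<-cmp (toℕ (partner ε c)) (toℕ c′)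
    ... | tri< pc<c′ _ _ = inj₁ (coord-< pc<c′)
    ... | tri≈ _ pc≡c′ _ =
      ⊥-elim (letter≢A ε (trans (sym (partner-letter ε wc)) (trans (cong w (toℕ-injective pc≡c′)) wc′)))
    ... | tri> _ _ c′<pc with ℕₚ.<-cmp (toℕ (partner ε c′)) (toℕ (partner ε c))
    ...   | tri< pc′<pc _ _ = inj₂ (inj₂ (inj₁ (coord-< c<c′ , coord-< pc′<pc)))
    ...   | tri≈ _ pc′≡pc _ =
      ⊥-elim (ℕₚ.<⇒≢ c<c′ (cong toℕ (partner-injective ε wc wc′ (sym (toℕ-injective pc′≡pc)))))
    ...   | tri> _ _ pc<pc′ = ⊥-elim (partner-noncrossing ε wc wc′ (c<c′ , c′<pc , pc<pc′))

  coloured-disjointOrNested : ∀ {ε f g} → Coloured ε f → Coloured ε g → f ≢ g →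
    DisjointOrNested (coord (left f)) (coord (right f)) (coord (left g)) (coord (right g))
  coloured-disjointOrNested {ε} {c , _} {c′ , _} (wc , refl) (wc′ , refl) f≢g
    with ℕₚ.<-cmp (toℕ c) (toℕ c′)
  ... | tri< c<c′ _ _ = ordered-disjointOrNested ε wc wc′ c<c′
  ... | tri≈ _ c≡c′ _ = ⊥-elim (f≢g (cong (λ x → x , partner ε x) (toℕ-injective c≡c′)))
  ... | tri> _ _ c′<c = DisjointOrNested-sym (ordered-disjointOrNested ε wc′ wc c′<c)

  -- Arcs crossing e belong to the other matching than e, hence to the same one.
  crossers-disjointOrNested : ∀ {e f g} → ArcOf e → OnArc e (mid f) → OnArc e (mid g) → f ≢ g →
    DisjointOrNested (coord (left f)) (coord (right f)) (coord (left g)) (coord (right g))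
  crossers-disjointOrNested ae (af , e×f) (ag , e×g) f≢g with colour ae | colour af | colour ag
  ... | εB , ce | εB , cf | _ = ⊥-elim (coloured-noncrossing ce cf e×f)
  ... | εC , ce | εC , cf | _ = ⊥-elim (coloured-noncrossing ce cf e×f)
  ... | εB , ce | _ | εB , cg = ⊥-elim (coloured-noncrossing ce cg e×g)
  ... | εC , ce | _ | εC , cg = ⊥-elim (coloured-noncrossing ce cg e×g)
  ... | εB , _ | εC , cf | εC , cg = coloured-disjointOrNested cf cg f≢g
  ... | εC , _ | εB , cf | εB , cg = coloured-disjointOrNested cf cg f≢g

  NLt-trichotomy : ∀ {e x y} → ArcOf e → OnArc e x → OnArc e y → x ≡ y ⊎ NLt e x y ⊎ NLt e y x
  NLt-trichotomy {x = start} {start} _ _ _ = inj₁ refl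
  NLt-trichotomy {x = start} {mid _} _ _ _ = inj₂ (inj₁ tt)
  NLt-trichotomy {x = start} {end} _ _ _ = inj₂ (inj₁ tt)
  NLt-trichotomy {x = mid _} {start} _ _ _ = inj₂ (inj₂ tt)
  NLt-trichotomy {x = mid _} {end} _ _ _ = inj₂ (inj₁ tt)
  NLt-trichotomy {x = end} {start} _ _ _ = inj₂ (inj₂ tt)
  NLt-trichotomy {x = end} {mid _} _ _ _ = inj₂ (inj₂ tt)
  NLt-trichotomy {x = end} {end} _ _ _ = inj₁ refl
  NLt-trichotomy {e} {mid f} {mid g} ae on-f@(_ , e×f) on-g@(_ , e×g) with f ≟ᵃ g
  ... | yes refl = inj₁ refl
  ... | no f≢g with ℤₚ.<-cmp (xNum e f * xDen e g) (xNum e g * xDen e f)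
  ...   | tri< f<g _ _ = inj₂ (inj₁ f<g)
  ...   | tri> _ _ g<f = inj₂ (inj₂ g<f)
  ...   | tri≈ _ f≈g _ = ⊥-elim (meetAt-same-point (crossing-meets e f e×f) (crossing-meets e g e×g) f≈g
                                   (crossers-disjointOrNested ae on-f on-g f≢g))

  NLt-irrefl : ∀ {e x} → ¬ NLt e x x
  NLt-irrefl {x = mid _} = ℤₚ.<-irrefl refl

  NLt-trans : ∀ {e x y z} → OnArc e x → OnArc e y → OnArc e z → NLt e x y → NLt e y z → NLt e x z
  NLt-trans {x = start} {mid _} {mid _} _ _ _ _ _ = tt
  NLt-trans {x = start} {mid _} {end} _ _ _ _ _ = tt
  NLt-trans {x = mid _} {mid _} {end} _ _ _ _ _ = tt
  NLt-trans {e} {mid f} {mid g} {mid h} (_ , e×f) (_ , e×g) (_ , e×h) f<g g<h =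
    fraction-<-trans {xNum e f} {n₂ = xNum e g} {n₃ = xNum e h}
      (MeetAt.0<den (crossing-meets e f e×f)) (MeetAt.0<den (crossing-meets e g e×g))
      (MeetAt.0<den (crossing-meets e h e×h)) f<g g<h

  nodes : List (Node {N})
  nodes = start ∷ end ∷ map mid (cartesianProduct (allFin N) (allFin N))

  ∈-nodes : ∀ x → x ∈ nodes
  ∈-nodes start = here refl
  ∈-nodes end = there (here refl)
  ∈-nodes (mid (a , b)) = there (there (∈-map⁺ mid (∈-cartesianProduct⁺ (∈-allFin a) (∈-allFin b))))

  Succ-exists : ∀ e x → OnArc e x → NLt e x end → ∃ (Succ e x)
  Succ-exists e x on-x x<end =
    let y , on-y , x<y , immediate = cover nodes ∈-nodes x end tt x<end
    in y , on-x , on-y , x<y , immediate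
    where open ImmediateSuccessor (OnArc e) (OnArc? e) (NLt e) (NLt? e) NLt-trans NLt-irrefl

  Pred-exists : ∀ e y → OnArc e y → NLt e start y → ∃ λ x → Succ e x y
  Pred-exists e y on-y start<y =
    let x , on-x , x<y , immediate = cover nodes ∈-nodes y start tt start<y
    in x , on-x , on-y , x<y , λ z on-z x<z z<y → immediate z on-z z<y x<z
    where open ImmediateSuccessor (OnArc e) (OnArc? e) (flip (NLt e)) (flip (NLt? e))
                                  (λ on-x on-y on-z y<x z<y → NLt-trans on-z on-y on-x z<y y<x) NLt-irrefl

  Succ-injective : ∀ {e x x′ y} → ArcOf e → Succ e x y → Succ e x′ y → x ≡ x′
  Succ-injective ae (on-x , _ , x<y , imm) (on-x′ , _ , x′<y , imm′) with NLt-trichotomy ae on-x on-x′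
  ... | inj₁ x≡x′ = x≡x′
  ... | inj₂ (inj₁ x<x′) = ⊥-elim (imm _ on-x′ x<x′ x′<y)
  ... | inj₂ (inj₂ x′<x) = ⊥-elim (imm′ _ on-x x′<x x<y)

  Succ-functional : ∀ {e x y y′} → ArcOf e → Succ e x y → Succ e x y′ → y ≡ y′
  Succ-functional ae (_ , on-y , x<y , imm) (_ , on-y′ , x<y′ , imm′) with NLt-trichotomy ae on-y on-y′
  ... | inj₁ y≡y′ = y≡y′
  ... | inj₂ (inj₁ y<y′) = ⊥-elim (imm′ _ on-y x<y y<y′)
  ... | inj₂ (inj₂ y′<y) = ⊥-elim (imm _ on-y′ x<y′ y′<y)

  Coloured⇒ArcOf : ∀ {ε e} → Coloured ε e → ArcOf e
  Coloured⇒ArcOf {εB} (wa , b≡pB) = wa , inj₁ b≡pB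
  Coloured⇒ArcOf {εC} (wa , b≡pC) = wa , inj₂ b≡pC

  letter-Coloured : ∀ ε {j} → w j ≡ letter ε → Coloured ε (partner ε j , j)
  letter-Coloured ε {j} wj = let wpj , ppj≡j = proj₁ (proj₂ (partner-isNCPM ε)) j wj in wpj , sym ppj≡j

  right-≢A : ∀ {e} → ArcOf e → w (right e) ≢ A
  right-≢A ae with colour ae
  ... | ε , wa , refl = letter≢A ε ∘ trans (sym (partner-letter ε wa))

  endArc-letter : ∀ ε {j} → w j ≡ letter ε → endArc j ≡ (partner ε j , j)
  endArc-letter εB wj rewrite wj = refl
  endArc-letter εC wj rewrite wj = refl

  endArc-ArcOf : ∀ {j} → w j ≢ A → ArcOf (endArc j) × right (endArc j) ≡ j
  endArc-ArcOf {j} wj≢A with w j in wj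
  ... | A = ⊥-elim (wj≢A refl)
  ... | B = Coloured⇒ArcOf (letter-Coloured εB wj) , refl
  ... | C = Coloured⇒ArcOf (letter-Coloured εC wj) , refl

  endArc-right : ∀ {e} → ArcOf e → endArc (right e) ≡ e
  endArc-right ae with colour ae
  ... | ε , wa , refl =
    trans (endArc-letter ε (partner-letter ε wa)) (cong (_, partner ε _) (partner-involutive ε wa))

  left-small : ∀ a → left (small a) ≡ a
  left-small a with toℕ (pB a) <ᵇ toℕ (pC a)
  ... | true = refl
  ... | false = refl

  left-large : ∀ a → left (large a) ≡ a
  left-large a with toℕ (pB a) <ᵇ toℕ (pC a)
  ... | true = refl
  ... | false = refl

  small-ArcOf : ∀ {a} → w a ≡ A → ArcOf (small a)
  small-ArcOf {a} wa with toℕ (pB a) <ᵇ toℕ (pC a)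
  ... | true = wa , inj₁ refl
  ... | false = wa , inj₂ refl

  large-ArcOf : ∀ {a} → w a ≡ A → ArcOf (large a)
  large-ArcOf {a} wa with toℕ (pB a) <ᵇ toℕ (pC a)
  ... | true = wa , inj₂ refl
  ... | false = wa , inj₁ refl

  right-small≢right-large : ∀ {a} → w a ≡ A → right (small a) ≢ right (large a)
  right-small≢right-large {a} wa with toℕ (pB a) <ᵇ toℕ (pC a)
  ... | true = pB≢pC wa
  ... | false = pB≢pC wa ∘ sym

  small≢large : ∀ {a} → w a ≡ A → small a ≢ large a
  small≢large wa = right-small≢right-large wa ∘ cong right

  large-injective : ∀ {a a′} → large a ≡ large a′ → a ≡ a′
  large-injective {a} {a′} eq = trans (sym (left-large a)) (trans (cong left eq) (left-large a′))

  small⊎large : ∀ {e} → ArcOf e → e ≡ small (left e) ⊎ e ≡ large (left e)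
  small⊎large {a , _} (_ , inj₁ refl) with toℕ (pB a) <ᵇ toℕ (pC a)
  ... | true = inj₁ refl
  ... | false = inj₂ refl
  small⊎large {a , _} (_ , inj₂ refl) with toℕ (pB a) <ᵇ toℕ (pC a)
  ... | true = inj₂ refl
  ... | false = inj₁ refl

  ¬small⇒large : ∀ {e} → ArcOf e → e ≢ small (left e) → e ≡ large (left e)
  ¬small⇒large ae e≢small with small⊎large ae
  ... | inj₁ e-small = ⊥-elim (e≢small e-small)
  ... | inj₂ e-large = e-large

  first⊎first : ∀ {e f} → Crosses e f → First e f ⊎ First f e
  first⊎first (inj₁ (a<c , _)) = inj₁ a<c
  first⊎first (inj₂ (c<a , _)) = inj₂ c<a

  Crosses-sym : ∀ {e f} → Crosses e f → Crosses f e
  Crosses-sym (inj₁ a<c<b<d) = inj₂ a<c<b<d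
  Crosses-sym (inj₂ c<a<d<b) = inj₁ c<a<d<b

  ≮⇒First : ∀ {e f} → Crosses e f → ¬ First e f → First f e
  ≮⇒First e×f e≮f with first⊎first e×f
  ... | inj₁ e<f = ⊥-elim (e≮f e<f)
  ... | inj₂ f<e = f<e

  NLt-start : ∀ {e x} → ¬ NLt e x start
  NLt-start {x = start} ()
  NLt-start {x = mid _} ()
  NLt-start {x = end} ()

  NLt-end : ∀ {e x y} → NLt e x y → NLt e x end
  NLt-end {x = start} _ = tt
  NLt-end {x = mid _} _ = tt

  seg-toEnd-black : ∀ e x → kindW (seg e x toEnd) ≡ black
  seg-toEnd-black e start = refl
  seg-toEnd-black e (mid _) = refl
  seg-toEnd-black e end = refl

  ccw-start-small : ∀ {e} → e ≡ small (left e) → ccwW (seg e start toEnd) ≡ seg (large (left e)) start toEnd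
  ccw-start-small {e} e-small = cong (λ b → if b then seg (large (left e)) start toEnd else tT (left e))
    (≡ᵇ≡true (cong (toℕ ∘ right) e-small))

  ccw-start-large : ∀ {e} → ArcOf e → e ≡ large (left e) → ccwW (seg e start toEnd) ≡ tT (left e)
  ccw-start-large {e} (wa , _) e-large = cong (λ b → if b then seg (large (left e)) start toEnd else tT (left e))
    (≡ᵇ≡false λ same → right-small≢right-large wa (trans (sym (toℕ-injective same)) (cong right e-large)))

  ccw-toEnd-first : ∀ {e f} → First e f → ccwW (seg e (mid f) toEnd) ≡ seg f (mid e) toEnd
  ccw-toEnd-first {e} {f} e<f = cong (λ b → if b then seg f (mid e) toEnd else bw f e) (<ᵇ≡true e<f)

  ccw-toEnd-second : ∀ {e f} → First f e → ccwW (seg e (mid f) toEnd) ≡ bw f e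
  ccw-toEnd-second {e} {f} f<e =
    cong (λ b → if b then seg f (mid e) toEnd else bw f e) (<ᵇ≡false (ℕₚ.<⇒≯ f<e))

  cw-toStart-first : ∀ {e f} → First e f → cwW (seg e (mid f) toStart) ≡ wb e f
  cw-toStart-first {e} {f} e<f = cong (λ b → if b then wb e f else seg f (mid e) toStart) (<ᵇ≡true e<f)

  cw-toStart-second : ∀ {e f} → First f e → cwW (seg e (mid f) toStart) ≡ seg f (mid e) toStart
  cw-toStart-second {e} {f} f<e =
    cong (λ b → if b then wb e f else seg f (mid e) toStart) (<ᵇ≡false (ℕₚ.<⇒≯ f<e))

  Walk : WDart → Fin N → Set
  Walk = TripRun webW

  walk-along : ∀ {d d′ j} → d ≡ d′ → Walk d j → Walk d′ j
  walk-along {j = j} = subst (λ d → Walk d j)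

  mutual
    SRun⇒Walk-toEnd : ∀ {e x y j} → ArcOf e → Succ e x y → SRun e y toEnd j → Walk (seg e x toEnd) j
    SRun⇒Walk-toEnd ae s stopEnd = arrive (pE ae s) refl
    SRun⇒Walk-toEnd ae s (fromA e<f s′ r) =
      turnL (pS ae s) refl (walk-along (sym (cw-toStart-first e<f)) (turnR pX refl (SRun⇒Walk-toEnd ae s′ r)))
    SRun⇒Walk-toEnd ae s@(_ , (af , _) , _) (fromC f<e s′ r) =
      turnL (pS ae s) refl (walk-along (sym (cw-toStart-second f<e)) (SRun⇒Walk-toStart af s′ r))

    SRun⇒Walk-toStart : ∀ {e g y j} → ArcOf e → Succ e y (mid g) → SRun e y toStart j →
      Walk (seg e (mid g) toStart) j
    SRun⇒Walk-toStart {e} {y = y} ae s@(on-y , _) r =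
      turnR (pS' ae s) (seg-toEnd-black e y) (SRun⇒Walk-arrive ae on-y r)

    SRun⇒Walk-arrive : ∀ {e y j} → ArcOf e → OnArc e y → SRun e y toStart j →
      Walk (ccwW (seg e y toEnd)) j
    SRun⇒Walk-arrive ae _ (stopA e-large) =
      walk-along (sym (ccw-start-large ae e-large)) (arrive (pA' (proj₁ ae)) refl)
    SRun⇒Walk-arrive ae _ (turnA e-small s r) =
      walk-along (sym (ccw-start-small e-small)) (SRun⇒Walk-toEnd (large-ArcOf (proj₁ ae)) s r)
    SRun⇒Walk-arrive ae (af , _) (fromB e<f s r) =
      walk-along (sym (ccw-toEnd-first e<f)) (SRun⇒Walk-toEnd af s r)
    SRun⇒Walk-arrive ae _ (fromD f<e s r) =
      walk-along (sym (ccw-toEnd-second f<e)) (turnL pX' refl (SRun⇒Walk-toStart ae s r))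

  <ᵇ⇒First : ∀ {e f} → (toℕ (left e) <ᵇ toℕ (left f)) ≡ true → First e f
  <ᵇ⇒First {e} {f} eq = ℕₚ.<ᵇ⇒< (toℕ (left e)) (toℕ (left f)) (Equivalence.from T-≡ eq)

  ≮ᵇ⇒First : ∀ {e f} → Crosses e f → (toℕ (left e) <ᵇ toℕ (left f)) ≡ false → First f e
  ≮ᵇ⇒First e×f eq = ≮⇒First e×f λ e<f → contradiction (trans (sym eq) (<ᵇ≡true e<f)) λ ()

  small-test : Arc → Bool
  small-test e = toℕ (right e) ≡ᵇ toℕ (right (small (left e)))

  ≡ᵇ⇒small : ∀ {e} → small-test e ≡ true → e ≡ small (left e)
  ≡ᵇ⇒small {e} eq =
    cong₂ _,_ (sym (left-small (left e))) (toℕ-injective (ℕₚ.≡ᵇ⇒≡ _ _ (Equivalence.from T-≡ eq)))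

  ≢ᵇ⇒large : ∀ {e} → ArcOf e → small-test e ≡ false → e ≡ large (left e)
  ≢ᵇ⇒large ae eq = ¬small⇒large ae λ e-small →
    contradiction (trans (sym eq) (≡ᵇ≡true (cong (toℕ ∘ right) e-small))) λ ()

  -- Splitting on the very tests made by ccwW and cwW makes the walk's type reduce, so that
  -- the recursion is structural.
  mutual
    Walk⇒SRun-toEnd : ∀ {e x j} → ArcOf e → Walk (seg e x toEnd) j →
      ∃ λ y → Succ e x y × SRun e y toEnd j
    Walk⇒SRun-toEnd ae (arrive (pE _ s) refl) = end , s , stopEnd
    Walk⇒SRun-toEnd ae (arrive (pS _ _) ())
    Walk⇒SRun-toEnd ae (turnL (pS _ s@(_ , on-g , _)) refl r) = _ , s , Walk⇒SRun-crossing ae on-g r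
    Walk⇒SRun-toEnd ae (turnL (pE _ _) () _)
    Walk⇒SRun-toEnd ae (turnR (pS _ _) () _)
    Walk⇒SRun-toEnd ae (turnR (pE _ _) () _)

    Walk⇒SRun-crossing : ∀ {e g j} → ArcOf e → OnArc e (mid g) → Walk (cwW (seg e (mid g) toStart)) j →
      SRun e (mid g) toEnd j
    Walk⇒SRun-crossing {e} {g} ae (ag , e×g) r with toℕ (left e) <ᵇ toℕ (left g) in eq
    Walk⇒SRun-crossing {e} {g} ae _ (turnR pX refl r) | true =
      let _ , s , r′ = Walk⇒SRun-toEnd ae r in fromA (<ᵇ⇒First {e} {g} eq) s r′
    Walk⇒SRun-crossing ae _ (arrive pX ()) | true
    Walk⇒SRun-crossing ae _ (turnL pX () _) | true
    Walk⇒SRun-crossing ae (ag , e×g) r | false =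
      let _ , s , r′ = Walk⇒SRun-toStart ag r in fromC (≮ᵇ⇒First e×g eq) s r′

    Walk⇒SRun-toStart : ∀ {e g j} → ArcOf e → Walk (seg e (mid g) toStart) j →
      ∃ λ y → Succ e y (mid g) × SRun e y toStart j
    Walk⇒SRun-toStart {e} ae (arrive (pS' {x = x} _ _) k) with () ← trans (sym (seg-toEnd-black e x)) k
    Walk⇒SRun-toStart {e} ae (turnL (pS' {x = x} _ _) k _) with () ← trans (sym (seg-toEnd-black e x)) k
    Walk⇒SRun-toStart ae (turnR (pS' _ s@(on-x , _ , x<g , _)) _ r) =
      _ , s , Walk⇒SRun-arrive ae on-x (NLt-end x<g) r

    Walk⇒SRun-arrive : ∀ {e y j} → ArcOf e → OnArc e y → NLt e y end → Walk (ccwW (seg e y toEnd)) j →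
      SRun e y toStart j
    Walk⇒SRun-arrive {e} {start} ae _ _ r with small-test e in eq
    ... | true = let _ , s , r′ = Walk⇒SRun-toEnd (large-ArcOf (proj₁ ae)) r in turnA (≡ᵇ⇒small eq) s r′
    Walk⇒SRun-arrive ae _ _ (arrive (pA' _) refl) | false = stopA (≢ᵇ⇒large ae eq)
    Walk⇒SRun-arrive ae _ _ (turnR (pA' _) () _) | false
    Walk⇒SRun-arrive ae _ _ (turnL (pA' _) () _) | false
    Walk⇒SRun-arrive {e} {mid f} ae (af , e×f) _ r with toℕ (left e) <ᵇ toℕ (left f) in eq
    ... | true = let _ , s , r′ = Walk⇒SRun-toEnd af r in fromB (<ᵇ⇒First {e} {f} eq) s r′
    Walk⇒SRun-arrive ae (_ , e×f) _ (turnL pX' refl r) | false =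
      let _ , s , r′ = Walk⇒SRun-toStart ae r in fromD (≮ᵇ⇒First e×f eq) s r′
    Walk⇒SRun-arrive ae _ _ (arrive pX' ()) | false
    Walk⇒SRun-arrive ae _ _ (turnR pX' () _) | false

  Sigma⇒Trip : ∀ {i j} → Sigma i j → Trip webW i j
  Sigma⇒Trip (inj₁ (wa , _ , s , r)) = turnR (pA wa) refl (SRun⇒Walk-toEnd (small-ArcOf wa) s r)
  Sigma⇒Trip {j = j} (inj₂ (wi≢A , y , s@(on-y , _) , r)) =
    let ae , right≡i = endArc-ArcOf wi≢A
    in subst (λ k → Walk (bd k) j) right≡i
             (turnR (pE' ae s) (seg-toEnd-black _ y) (SRun⇒Walk-arrive ae on-y r))

  Trip⇒Sigma : ∀ {i j} → Trip webW i j → Sigma i j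
  Trip⇒Sigma (turnR (pA wa) refl r) = inj₁ (wa , Walk⇒SRun-toEnd (small-ArcOf wa) r)
  Trip⇒Sigma (arrive (pA _) ())
  Trip⇒Sigma (turnL (pA _) () _)
  Trip⇒Sigma (arrive (pE' {e} {x} _ _) k) with () ← trans (sym (seg-toEnd-black e x)) k
  Trip⇒Sigma (turnL (pE' {e} {x} _ _) k _) with () ← trans (sym (seg-toEnd-black e x)) k
  Trip⇒Sigma {j = j} (turnR (pE' ae s@(on-x , _ , x<end , _)) _ r) =
    inj₂ (right-≢A ae , subst (λ e → ∃ λ y → Succ e y end × SRun e y toStart j) (sym (endArc-right ae))
                              (_ , s , Walk⇒SRun-arrive ae on-x x<end r))

  -- A state (e , x , d) is the walk of σ_w leaving the node x of the arc e in direction d.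
  State : Set
  State = Arc × Node {N} × Dir

  Departs : State → Set
  Departs (e , x , toEnd) = ArcOf e × OnArc e x × NLt e x end
  Departs (e , x , toStart) = ArcOf e × OnArc e x × NLt e start x

  Departs? : ∀ t → Dec (Departs t)
  Departs? (e , x , toEnd) = ArcOf? e ×-dec OnArc? e x ×-dec NLt? e x end
  Departs? (e , x , toStart) = ArcOf? e ×-dec OnArc? e x ×-dec NLt? e start x

  Ends : State → Fin N → Set
  Ends (e , x , toEnd) j = ∃ λ y → Succ e x y × SRun e y toEnd j
  Ends (e , x , toStart) j = ∃ λ y → Succ e y x × SRun e y toStart j

  data _↦_ : State → State → Set where
    pass-first   : ∀ {e x f} → First e f → Succ e x (mid f) → (e , x , toEnd) ↦ (e , mid f , toEnd)
    turn-second  : ∀ {e x f} → ¬ First e f → Succ e x (mid f) → (e , x , toEnd) ↦ (f , mid e , toStart)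
    turn-first   : ∀ {e x f} → First e f → Succ e (mid f) x → (e , x , toStart) ↦ (f , mid e , toEnd)
    pass-second  : ∀ {e x f} → ¬ First e f → Succ e (mid f) x → (e , x , toStart) ↦ (e , mid f , toStart)
    switch-large : ∀ {e x g} → e ≡ small (left e) → Succ e start x → g ≡ large (left e) →
                   (e , x , toStart) ↦ (g , start , toEnd)

  data Halts : State → Fin N → Set where
    at-end   : ∀ {e x} → Succ e x end → Halts (e , x , toEnd) (right e)
    at-start : ∀ {e x} → e ≢ small (left e) → Succ e start x → Halts (e , x , toStart) (left e)

  data Move (t : State) : Set where
    continue : ∀ u → t ↦ u → Move t
    halt     : ∀ j → Halts t j → Move t

  move : ∀ t → Departs t → Move t
  move (e , x , toEnd) (ae , on-x , x<end) with Succ-exists e x on-x x<end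
  ... | start , (_ , _ , x<start , _) = ⊥-elim (NLt-start x<start)
  ... | end , s = halt _ (at-end s)
  ... | mid f , s with toℕ (left e) ℕₚ.<? toℕ (left f)
  ...   | yes e<f = continue _ (pass-first e<f s)
  ...   | no e≮f = continue _ (turn-second e≮f s)
  move (e , x , toStart) (ae , on-x , start<x) with Pred-exists e x on-x start<x
  ... | start , s with e ≟ᵃ small (left e)
  ...   | yes e-small = continue _ (switch-large e-small s refl)
  ...   | no e≢small = halt _ (at-start e≢small s)
  move (e , x , toStart) (ae , on-x , start<x) | mid f , s with toℕ (left e) ℕₚ.<? toℕ (left f)
  ...   | yes e<f = continue _ (turn-first e<f s)
  ...   | no e≮f = continue _ (pass-second e≮f s)

  -- Off the states that occur, the step function is junk: it stays put.
  step : State → State ⊎ Fin N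
  step t with Departs? t
  ... | no _ = inj₁ t
  ... | yes d with move t d
  ...   | continue u _ = inj₁ u
  ...   | halt j _ = inj₂ j

  step-↦ : ∀ {t u} → Departs t → step t ≡ inj₁ u → t ↦ u
  step-↦ {t} d eq with Departs? t
  ... | no ¬d = ⊥-elim (¬d d)
  ... | yes d′ with move t d′ | eq
  ...   | continue _ t↦u | refl = t↦u

  step-Halts : ∀ {t j} → Departs t → step t ≡ inj₂ j → Halts t j
  step-Halts {t} d eq with Departs? t
  ... | no ¬d = ⊥-elim (¬d d)
  ... | yes d′ with move t d′ | eq
  ...   | halt _ h | refl = h

  ↦-Departs : ∀ {t u} → Departs t → t ↦ u → Departs u
  ↦-Departs (ae , _) (pass-first _ (_ , on-f , _)) = ae , on-f , tt
  ↦-Departs (ae , _) (turn-second _ (_ , (af , e×f) , _)) = af , (ae , Crosses-sym e×f) , tt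
  ↦-Departs (ae , _) (turn-first _ ((af , e×f) , _)) = af , (ae , Crosses-sym e×f) , tt
  ↦-Departs (ae , _) (pass-second _ (on-f , _)) = ae , on-f , tt
  ↦-Departs (ae , _) (switch-large _ _ refl) = large-ArcOf (proj₁ ae) , tt , tt

  ↦-injective : ∀ {t t′ u} → Departs t → Departs t′ → t ↦ u → t′ ↦ u → t ≡ t′
  ↦-injective (ae , _) _ (pass-first _ s) (pass-first _ s′) =
    cong (λ x → _ , x , toEnd) (Succ-injective ae s s′)
  ↦-injective (ae , _) _ (turn-second _ s) (turn-second _ s′) =
    cong (λ x → _ , x , toEnd) (Succ-injective ae s s′)
  ↦-injective (ae , _) _ (turn-first _ s) (turn-first _ s′) =
    cong (λ x → _ , x , toStart) (Succ-functional ae s s′)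
  ↦-injective (ae , _) _ (pass-second _ s) (pass-second _ s′) =
    cong (λ x → _ , x , toStart) (Succ-functional ae s s′)
  ↦-injective {e , _ , _} (ae , _) _ (switch-large e-small s g-large) (switch-large e′-small s′ g-large′)
    with refl ← large-injective (trans (sym g-large) g-large′)
    with refl ← trans e-small (sym e′-small) =
    cong (λ x → e , x , toStart) (Succ-functional ae s s′)
  ↦-injective _ _ (pass-first e<f _) (turn-first f<e _) = ⊥-elim (ℕₚ.<-asym e<f f<e)
  ↦-injective _ _ (turn-first e<f _) (pass-first f<e _) = ⊥-elim (ℕₚ.<-asym e<f f<e)
  ↦-injective _ _ (turn-second e≮f (_ , (_ , e×f) , _)) (pass-second f≮e _) = ⊥-elim (f≮e (≮⇒First e×f e≮f))
  ↦-injective _ _ (pass-second f≮e _) (turn-second e≮f (_ , (_ , e×f) , _)) = ⊥-elim (f≮e (≮⇒First e×f e≮f))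

  Ends-↦ : ∀ {t u j} → t ↦ u → Ends u j → Ends t j
  Ends-↦ (pass-first e<f s) (_ , s′ , r) = _ , s , fromA e<f s′ r
  Ends-↦ (turn-second e≮f s@(_ , (_ , e×f) , _)) (_ , s′ , r) = _ , s , fromC (≮⇒First e×f e≮f) s′ r
  Ends-↦ (turn-first e<f s) (_ , s′ , r) = _ , s , fromB e<f s′ r
  Ends-↦ (pass-second e≮f s@((_ , e×f) , _)) (_ , s′ , r) = _ , s , fromD (≮⇒First e×f e≮f) s′ r
  Ends-↦ (switch-large e-small s refl) (_ , s′ , r) = _ , s , turnA e-small s′ r

  Ends-Halts : ∀ {t j} → Departs t → Halts t j → Ends t j
  Ends-Halts _ (at-end s) = _ , s , stopEnd
  Ends-Halts (ae , _) (at-start e≢small s) = _ , s , stopA (¬small⇒large ae e≢small)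

  node-code : Node {N} → Fin (2 ℕ.+ N ℕ.* N)
  node-code start = Fin.zero
  node-code end = Fin.suc Fin.zero
  node-code (mid (a , b)) = Fin.suc (Fin.suc (Fin.combine a b))

  node-code-injective : ∀ {x y} → node-code x ≡ node-code y → x ≡ y
  node-code-injective {start} {start} _ = refl
  node-code-injective {end} {end} _ = refl
  node-code-injective {mid (a , b)} {mid (c , d)} eq
    with refl , refl ← combine-injective a b c d (suc-injective (suc-injective eq)) = refl

  dir-code : Dir → Fin 2
  dir-code toStart = Fin.zero
  dir-code toEnd = Fin.suc Fin.zero

  dir-code-injective : ∀ {d d′} → dir-code d ≡ dir-code d′ → d ≡ d′
  dir-code-injective {toStart} {toStart} _ = refl
  dir-code-injective {toEnd} {toEnd} _ = refl

  code : State → Fin ((N ℕ.* N) ℕ.* ((2 ℕ.+ N ℕ.* N) ℕ.* 2))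
  code ((a , b) , x , d) = Fin.combine (Fin.combine a b) (Fin.combine (node-code x) (dir-code d))

  code-injective : ∀ {t u} → code t ≡ code u → t ≡ u
  code-injective {(a , b) , x , d} {(c , e) , y , d′} eq
    with eq-arc , eq-rest ← combine-injective (Fin.combine a b) _ (Fin.combine c e) _ eq
    with refl , refl ← combine-injective a b c e eq-arc
    with eq-node , eq-dir ← combine-injective (node-code x) (dir-code d) (node-code y) (dir-code d′) eq-rest
    with refl ← node-code-injective eq-node
    with refl ← dir-code-injective eq-dir = refl

  walk-ends : ∀ t → Departs t → (∀ {u} → ¬ u ↦ t) → ∃ (Ends t)
  walk-ends t d no-pred = Walk.result t d (λ u du eq → no-pred (step-↦ du eq)) Ends
    (λ du eq → Ends-↦ (step-↦ du eq)) (λ du eq → Ends-Halts du (step-Halts du eq))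
    where
    module Walk = InjectiveIteration step Departs (λ d eq → ↦-Departs d (step-↦ d eq))
      (λ d d′ eq eq′ → ↦-injective d d′ (step-↦ d eq) (step-↦ d′ eq′)) code code-injective

  ¬↦small-start : ∀ {a u} → w a ≡ A → ¬ u ↦ (small a , start , toEnd)
  ¬↦small-start {a} wa (switch-large {e} _ _ small≡large) =
    small≢large wa (trans small≡large (cong large left≡a))
    where
    left≡a : left e ≡ a
    left≡a = trans (sym (left-large (left e))) (trans (cong left (sym small≡large)) (left-small a))

  ¬↦end : ∀ {e u} → ¬ u ↦ (e , end , toStart)
  ¬↦end ()

  Sigma-total : ∀ i → ∃ (Sigma i)
  Sigma-total i with w i ≟ᴸ A
  ... | yes wa =
    let j , y , s , r = walk-ends (small i , start , toEnd) (small-ArcOf wa , tt , tt) (¬↦small-start wa)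
    in j , inj₁ (wa , y , s , r)
  ... | no wi≢A =
    let j , y , s , r = walk-ends (endArc i , end , toStart) (proj₁ (endArc-ArcOf wi≢A) , tt , tt) ¬↦end
    in j , inj₂ (wi≢A , y , s , r)

open import Data.Nat using (_≤_; _*_)
open import Data.Vec using (Vec; lookup)
open import Data.Product using (_×_; ∃; _,_)
open import Function.Bundles using (_⇔_; mk⇔)

proposition5p6 : (n : ℕ) → 1 ≤ n → (w : Vec Letter (3 * n)) → Kreweras n w →
    (pB pC : Fin (3 * n) → Fin (3 * n)) →
    IsNCPM (lookup w) B pB → IsNCPM (lookup w) C pC →
    ((i : Fin (3 * n)) → ∃ (λ j → Construction.Sigma (lookup w) pB pC i j)) ×
    ((i j : Fin (3 * n)) →
      Construction.Sigma (lookup w) pB pC i j ⇔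
      Trip (Construction.webW (lookup w) pB pC) i j)
-- Only the two noncrossing matchings are used; the Kreweras condition just guarantees they exist.
proposition5p6 n _ w _ pB pC ncB ncC = Sigma-total , λ _ _ → mk⇔ Sigma⇒Trip Trip⇒Sigma
  where open ArcDiagram (lookup w) pB pC ncB ncC
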